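{- Let $t\ge 2$ be an integer, let $H=(V,E)$ be an arbitrary simple $t$-uniform hypergraph, and let $U\subseteq V$. Then there exists a simple $t$-uniform hypergraph $H'$ on the vertex set $V$ such that: (i) $d_H(v)=d_{H'}(v)$ for all $v\in V\setminus U$; (ii) $\sum_{u\in U} d_H(u)=\sum_{u\in U} d_{H'}(u)$; (iii) the degrees of the vertices of $U$ in $H'$ are almost regular.
   Context: A hypergraph is simple if it has no repeated hyperedges; it is $t$-uniform if every hyperedge has exactly $t$ vertices. $d_H(v)$ denotes the number of hyperedges of $H$ containing $v$. A set of vertices is almost regular (in a hypergraph) if there is an integer $k$ such that each of these vertices has degree $k$ or $k+1$. -}

module Defs where

open import Data.Nat using (ℕ; suc; _+_)
open import Data.Fin using (Fin)
open import Data.Fin.Subset using (Subset; _∈_; _∉_; ∣_∣)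
open import Data.Fin.Subset.Properties using (_∈?_)
open import Data.List using (List; filter; length; map; allFin)
open import Data.Nat.ListAction using (sum)
open import Data.List.Relation.Unary.All using (All)
open import Data.List.Relation.Unary.Unique.Propositional using (Unique)
open import Data.Product using (_×_; ∃)
open import Data.Sum using (_⊎_)
open import Relation.Binary.PropositionalEquality using (_≡_)

Hypergraph : ℕ → Set
Hypergraph n = List (Subset n)

Simple : ∀ {n} → Hypergraph n → Set
Simple H = Unique H

Uniform : ∀ {n} → ℕ → Hypergraph n → Set
Uniform t H = All (λ e → ∣ e ∣ ≡ t) H

deg : ∀ {n} → Hypergraph n → Fin n → ℕ
deg H v = length (filter (v ∈?_) H)

degSum : ∀ {n} → Hypergraph n → Subset n → ℕ
degSum {n} H U = sum (map (deg H) (filter (_∈? U) (allFin n)))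

AlmostRegular : ∀ {n} → Hypergraph n → Subset n → Set
AlmostRegular H U = ∃ λ k → ∀ u → u ∈ U → (deg H u ≡ k) ⊎ (deg H u ≡ suc k)

{-# OPTIONS --safe #-}
-- While two vertices a, b ∈ U satisfy d(b) + 2 ≤ d(a), some edge e contains a but not b
-- and e − a + b is not an edge: otherwise e ↦ e − a + b (or e itself when b ∈ e) would
-- inject the edges at a into the edges at b, forcing d(a) ≤ d(b). Replacing e by e − a + b
-- keeps H simple and t-uniform, moves one unit of degree from a to b and fixes every other
-- degree. So Σ_{u ∈ U} d(u) is unchanged while Σ_{u ∈ U} d(u)² drops by 2(d(a) − d(b) − 1) > 0;
-- the process therefore stops, and it can only stop when U is almost regular.
module Submission where

open import Defs
open import Data.Nat using (ℕ; suc; _+_; _*_; _≤_; _<_; _≥_; z≤n; s≤s; z<s; s<s⁻¹; _≤?_)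
open import Data.Nat.Properties using (≤-trans; ≤-antisym; m≤n⇒m<n∨m≡n; m<1+n⇒m≤n; ≰⇒>; m≤n⇒∃[o]m+o≡n; m<m+n; m≢1+n+m; +-assoc; +-comm; +-suc; +-identityʳ; +-cancelʳ-≡; +-cancelʳ-<; +-monoʳ-<; <⇒≱; <-trans; n<1+n; +-commutativeSemigroup)
open import Data.Nat.Induction using (<-wellFounded)
open import Data.Nat.ListAction using (sum)
open import Data.Nat.Tactic.RingSolver using (solve-∀)
open import Data.Bool using (if_then_else_)
import Data.Bool.Properties as Bool
open import Data.Fin using (Fin; zero; suc; _≟_)
open import Data.Fin.Permutation using (Permutation; _⟨$⟩ʳ_; _⟨$⟩ˡ_; inverseʳ; transpose)
open import Data.Fin.Subset using (Subset; _∈_; _∉_; ∣_∣; inside; outside)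
open import Data.Fin.Subset.Properties using (_∈?_)
open import Data.Vec using (_∷_; lookup; tabulate; _[_]≔_)
open import Data.Vec.Properties using (≡-dec; lookup∘tabulate; lookup∘update; lookup∘update′; []=⇒lookup; lookup⇒[]=)
open import Data.Vec.Relation.Binary.Pointwise.Extensional using (ext; Pointwise-≡⇒≡)
open import Data.List using (List; []; _∷_; [_]; _++_; filter; length; map; allFin)
open import Data.List.Properties using (filter-++; length-++; length-map; filter-notAll)
open import Data.List.Extrema.Nat using (argmin-all; argmax-all; f[argmin]≤f[⊤]; f[argmin]≤f[xs]; f[⊥]≤f[argmax]; f[xs]≤f[argmax])
open import Data.List.Membership.Propositional using (find; lose) renaming (_∈_ to _∈ₗ_; _∉_ to _∉ₗ_)
open import Data.List.Membership.Propositional.Properties using (∈-filter⁺; ∈-filter⁻; ∈-map⁻; ∈-allFin; ∈-∃++)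
open import Data.List.Relation.Binary.Subset.Propositional using (_⊆_)
open import Data.List.Relation.Unary.All as All using (All; []; _∷_)
open import Data.List.Relation.Unary.All.Properties using (¬Any⇒All¬)
open import Data.List.Relation.Unary.Any as Any using (Any; here; there; any?)
open import Data.List.Relation.Unary.Unique.Propositional using (Unique; []; _∷_)
import Data.List.Relation.Unary.Unique.Propositional.Properties as Unique
open import Data.Product using (Σ; _×_; _,_; ∃; ∃₂; proj₂)
open import Data.Sum using (_⊎_; inj₁; inj₂)
open import Function using (_∘_)
open import Algebra.Properties.CommutativeSemigroup +-commutativeSemigroup using (x∙yz≈xz∙y; xy∙z≈xz∙y; xy∙z≈zy∙x)
open import Induction.WellFounded using (Acc; acc)
open import Relation.Binary.Definitions using (DecidableEquality)
open import Relation.Binary.PropositionalEquality using (_≡_; _≢_; refl; sym; trans; cong; cong₂; subst; module ≡-Reasoning)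
open import Relation.Nullary using (Dec; yes; no; does; ¬?; _×-dec_; contradiction)
open import Relation.Nullary.Decidable using (dec-true; dec-false; decidable-stable)
open ≡-Reasoning

square-transfer : ∀ {x y} → y < x → x * x + suc y * suc y < suc x * suc x + y * y
square-transfer {y = y} y<x with c , refl ← m≤n⇒∃[o]m+o≡n y<x =
  subst ((suc y + c) * (suc y + c) + suc y * suc y <_) (expand y c) (m<m+n _ z<s)
  where
  expand : ∀ y c → (suc y + c) * (suc y + c) + suc y * suc y + (2 + 2 * c) ≡ suc (suc y + c) * suc (suc y + c) + y * y
  expand = solve-∀

record UnitTransfer {A : Set} (f g : A → ℕ) (a b : A) : Set where
  field
    source : f a ≡ suc (g a)
    target : g b ≡ suc (f b)
    rest   : ∀ x → x ≢ a → x ≢ b → g x ≡ f x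

  source≢target : a ≢ b
  source≢target refl = m≢1+n+m (f a) (trans source (cong suc target))

module _ {A : Set} where

  All-replace : ∀ {P : A → Set} ys {zs x y} → P y → All P (ys ++ x ∷ zs) → All P (ys ++ y ∷ zs)
  All-replace []       py (_ ∷ pzs)  = py ∷ pzs
  All-replace (_ ∷ ys) py (pv ∷ pys) = pv ∷ All-replace ys py pys

  Unique-replace : ∀ ys {zs} {x y : A} → y ∉ₗ ys ++ x ∷ zs → Unique (ys ++ x ∷ zs) → Unique (ys ++ y ∷ zs)
  Unique-replace []       y∉ (_ ∷ u)   = ¬Any⇒All¬ _ (y∉ ∘ there) ∷ u
  Unique-replace (v ∷ ys) y∉ (v∉ ∷ u) =
    All-replace ys (λ v≡y → y∉ (here (sym v≡y))) v∉ ∷ Unique-replace ys (y∉ ∘ there) u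

  almostConstant-or-gap : ∀ (f : A → ℕ) xs →
    (∃ λ k → All (λ x → f x ≡ k ⊎ f x ≡ suc k) xs) ⊎ (∃₂ λ a b → a ∈ₗ xs × b ∈ₗ xs × suc (f b) < f a)
  almostConstant-or-gap f []       = inj₁ (0 , [])
  almostConstant-or-gap f (x ∷ xs) =
    classify (argmin-all f {P = _∈ₗ x ∷ xs} (here refl) (All.tabulate there))
             (argmax-all f {P = _∈ₗ x ∷ xs} (here refl) (All.tabulate there))
      (All.zip (f[argmin]≤f[⊤] {f = f} x xs ∷ f[argmin]≤f[xs] x xs , f[⊥]≤f[argmax] {f = f} x xs ∷ f[xs]≤f[argmax] x xs))
    where
    between : ∀ {k m} → k ≤ m → m ≤ suc k → m ≡ k ⊎ m ≡ suc k
    between k≤m m≤1+k with m≤n⇒m<n∨m≡n m≤1+k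
    ... | inj₁ m<1+k = inj₁ (≤-antisym (m<1+n⇒m≤n m<1+k) k≤m)
    ... | inj₂ m≡1+k = inj₂ m≡1+k
    classify : ∀ {min max} → min ∈ₗ x ∷ xs → max ∈ₗ x ∷ xs → All (λ y → f min ≤ f y × f y ≤ f max) (x ∷ xs) →
      (∃ λ k → All (λ y → f y ≡ k ⊎ f y ≡ suc k) (x ∷ xs)) ⊎ (∃₂ λ a b → a ∈ₗ x ∷ xs × b ∈ₗ x ∷ xs × suc (f b) < f a)
    classify {min} {max} min∈ max∈ bounds with f max ≤? suc (f min)
    ... | yes max≤1+min = inj₁ (f min , All.map (λ (min≤y , y≤max) → between min≤y (≤-trans y≤max max≤1+min)) bounds)
    ... | no max≰1+min  = inj₂ (max , min , max∈ , min∈ , ≰⇒> max≰1+min)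

module _ {A : Set} (_≟ᴬ_ : DecidableEquality A) where

  Unique-⊆⇒length≤ : ∀ {xs ys : List A} → Unique xs → xs ⊆ ys → length xs ≤ length ys
  Unique-⊆⇒length≤ [] _ = z≤n
  Unique-⊆⇒length≤ {x ∷ xs} {ys} (x∉xs ∷ unique) x∷xs⊆ys =
    ≤-trans (s≤s (Unique-⊆⇒length≤ unique xs⊆ys-x))
      (filter-notAll (¬? ∘ (x ≟ᴬ_)) ys (Any.map (λ x≡y x≢y → x≢y x≡y) (x∷xs⊆ys (here refl))))
    where
    xs⊆ys-x : xs ⊆ filter (¬? ∘ (x ≟ᴬ_)) ys
    xs⊆ys-x z∈xs = ∈-filter⁺ (¬? ∘ (x ≟ᴬ_)) (x∷xs⊆ys (there z∈xs)) (All.lookup x∉xs z∈xs)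

  sum-map-update : ∀ {f g : A → ℕ} {a xs} → Unique xs → a ∈ₗ xs → (∀ x → x ≢ a → g x ≡ f x) →
    sum (map f xs) + g a ≡ sum (map g xs) + f a
  sum-map-update {f} {g} {a} {a ∷ xs} (a∉xs ∷ _) (here refl) agree =
    begin
      f a + sum (map f xs) + g a ≡⟨ cong (λ s → f a + s + g a) (agree-on xs a∉xs) ⟩
      f a + sum (map g xs) + g a ≡⟨ xy∙z≈zy∙x (f a) _ (g a) ⟩
      g a + sum (map g xs) + f a ∎
    where
    agree-on : ∀ ys → All (a ≢_) ys → sum (map f ys) ≡ sum (map g ys)
    agree-on []       []         = refl
    agree-on (y ∷ ys) (a≢y ∷ a∉) = cong₂ _+_ (sym (agree y (a≢y ∘ sym))) (agree-on ys a∉)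
  sum-map-update {f} {g} {a} {x ∷ xs} (x∉xs ∷ unique) (there a∈xs) agree =
    begin
      f x + sum (map f xs) + g a   ≡⟨ +-assoc (f x) _ _ ⟩
      f x + (sum (map f xs) + g a) ≡⟨ cong₂ _+_ (sym (agree x (All.lookup x∉xs a∈xs))) (sum-map-update unique a∈xs agree) ⟩
      g x + (sum (map g xs) + f a) ≡⟨ +-assoc (g x) _ _ ⟨
      g x + sum (map g xs) + f a   ∎

  sum-map-update₂ : ∀ {f g : A → ℕ} {a b xs} → Unique xs → a ∈ₗ xs → b ∈ₗ xs → a ≢ b →
    (∀ x → x ≢ a → x ≢ b → g x ≡ f x) → sum (map f xs) + (g a + g b) ≡ sum (map g xs) + (f a + f b)
  sum-map-update₂ {f} {g} {a} {b} {xs} unique a∈xs b∈xs a≢b agree =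
    begin
      sum (map f xs) + (g a + g b) ≡⟨ x∙yz≈xz∙y _ (g a) (g b) ⟩
      sum (map f xs) + g b + g a   ≡⟨ cong (λ z → sum (map f xs) + z + g a) h[b] ⟨
      sum (map f xs) + h b + g a   ≡⟨ cong (_+ g a) (sum-map-update unique b∈xs h≗f) ⟩
      sum (map h xs) + f b + g a   ≡⟨ xy∙z≈xz∙y _ (f b) (g a) ⟩
      sum (map h xs) + g a + f b   ≡⟨ cong (_+ f b) (sum-map-update unique a∈xs g≗h) ⟩
      sum (map g xs) + h a + f b   ≡⟨ cong (λ z → sum (map g xs) + z + f b) h[a] ⟩
      sum (map g xs) + f a + f b   ≡⟨ +-assoc _ (f a) (f b) ⟩
      sum (map g xs) + (f a + f b) ∎
    where
    h : A → ℕ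
    h x = if does (x ≟ᴬ b) then g b else f x
    h[b] : h b ≡ g b
    h[b] rewrite dec-true (b ≟ᴬ b) refl = refl
    h[a] : h a ≡ f a
    h[a] rewrite dec-false (a ≟ᴬ b) a≢b = refl
    h≗f : ∀ x → x ≢ b → h x ≡ f x
    h≗f x x≢b rewrite dec-false (x ≟ᴬ b) x≢b = refl
    g≗h : ∀ x → x ≢ a → g x ≡ h x
    g≗h x x≢a with x ≟ᴬ b
    ... | yes refl = refl
    ... | no x≢b   = agree x x≢a x≢b

  module _ {f g : A → ℕ} {a b} (transfer : UnitTransfer f g a b)
           {xs} (unique : Unique xs) (a∈xs : a ∈ₗ xs) (b∈xs : b ∈ₗ xs) where
    open UnitTransfer transfer

    sum-map-transfer : sum (map f xs) ≡ sum (map g xs)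
    sum-map-transfer = +-cancelʳ-≡ (g a + g b) _ _ (begin
      sum (map f xs) + (g a + g b) ≡⟨ sum-map-update₂ unique a∈xs b∈xs source≢target rest ⟩
      sum (map g xs) + (f a + f b) ≡⟨ cong (λ z → sum (map g xs) + (z + f b)) source ⟩
      sum (map g xs) + (suc (g a) + f b) ≡⟨ cong (sum (map g xs) +_) (+-suc (g a) (f b)) ⟨
      sum (map g xs) + (g a + suc (f b)) ≡⟨ cong (λ z → sum (map g xs) + (g a + z)) target ⟨
      sum (map g xs) + (g a + g b) ∎)

    sum-map-square-transfer : suc (f b) < f a → sum (map (λ x → g x * g x) xs) < sum (map (λ x → f x * f x) xs)
    sum-map-square-transfer gap = +-cancelʳ-< (g a * g a + g b * g b) _ _
      (subst (sum (map (λ x → g x * g x) xs) + (g a * g a + g b * g b) <_) (sym exchange)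
        (+-monoʳ-< (sum (map (λ x → g x * g x) xs)) squares))
      where
      exchange : sum (map (λ x → f x * f x) xs) + (g a * g a + g b * g b)
               ≡ sum (map (λ x → g x * g x) xs) + (f a * f a + f b * f b)
      exchange = sum-map-update₂ unique a∈xs b∈xs source≢target (λ x x≢a x≢b → cong (λ y → y * y) (rest x x≢a x≢b))
      squares : g a * g a + g b * g b < f a * f a + f b * f b
      squares rewrite source | target = square-transfer (s<s⁻¹ gap)

_≟ₛ_ : ∀ {n} → DecidableEquality (Subset n)
_≟ₛ_ = ≡-dec Bool._≟_

_∈ₗ?_ : ∀ {n} (e : Subset n) (H : Hypergraph n) → Dec (e ∈ₗ H)
e ∈ₗ? H = any? (e ≟ₛ_) H

∉⇒lookup≡outside : ∀ {n} {p : Subset n} {i} → i ∉ p → lookup p i ≡ outside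
∉⇒lookup≡outside {p = p} {i} i∉p = Bool.¬-not (i∉p ∘ lookup⇒[]= i p)

∣p[i]≔outside∣ : ∀ {n} (p : Subset n) i → lookup p i ≡ inside → suc ∣ p [ i ]≔ outside ∣ ≡ ∣ p ∣
∣p[i]≔outside∣ (inside  ∷ p) zero    refl = refl
∣p[i]≔outside∣ (outside ∷ p) zero    ()
∣p[i]≔outside∣ (inside  ∷ p) (suc i) p[i] = cong suc (∣p[i]≔outside∣ p i p[i])
∣p[i]≔outside∣ (outside ∷ p) (suc i) p[i] = ∣p[i]≔outside∣ p i p[i]

∣p[i]≔inside∣ : ∀ {n} (p : Subset n) i → lookup p i ≡ outside → ∣ p [ i ]≔ inside ∣ ≡ suc ∣ p ∣
∣p[i]≔inside∣ (inside  ∷ p) zero    ()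
∣p[i]≔inside∣ (outside ∷ p) zero    refl = refl
∣p[i]≔inside∣ (inside  ∷ p) (suc i) p[i] = cong suc (∣p[i]≔inside∣ p i p[i])
∣p[i]≔inside∣ (outside ∷ p) (suc i) p[i] = ∣p[i]≔inside∣ p i p[i]

relabel : ∀ {m n} → Permutation m n → Subset n → Subset m
relabel π p = tabulate (λ i → lookup p (π ⟨$⟩ʳ i))

module _ {m n} (π : Permutation m n) where

  lookup-relabel : ∀ p i → lookup (relabel π p) i ≡ lookup p (π ⟨$⟩ʳ i)
  lookup-relabel p = lookup∘tabulate _

  relabel-injective : ∀ {p q} → relabel π p ≡ relabel π q → p ≡ q
  relabel-injective {p} {q} πp≡πq = Pointwise-≡⇒≡ (ext λ i → begin
    lookup p i                       ≡⟨ cong (lookup p) (inverseʳ π) ⟨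
    lookup p (π ⟨$⟩ʳ (π ⟨$⟩ˡ i))      ≡⟨ lookup-relabel p (π ⟨$⟩ˡ i) ⟨
    lookup (relabel π p) (π ⟨$⟩ˡ i)  ≡⟨ cong (λ r → lookup r (π ⟨$⟩ˡ i)) πp≡πq ⟩
    lookup (relabel π q) (π ⟨$⟩ˡ i)  ≡⟨ lookup-relabel q (π ⟨$⟩ˡ i) ⟩
    lookup q (π ⟨$⟩ʳ (π ⟨$⟩ˡ i))      ≡⟨ cong (lookup q) (inverseʳ π) ⟩
    lookup q i                       ∎)

  ∈-relabel⁺ : ∀ {p i} → π ⟨$⟩ʳ i ∈ p → i ∈ relabel π p
  ∈-relabel⁺ {p} {i} πi∈p = lookup⇒[]= i (relabel π p) (trans (lookup-relabel p i) ([]=⇒lookup πi∈p))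

  ∈-relabel⁻ : ∀ {p i} → i ∈ relabel π p → π ⟨$⟩ʳ i ∈ p
  ∈-relabel⁻ {p} {i} i∈πp = lookup⇒[]= (π ⟨$⟩ʳ i) p (trans (sym (lookup-relabel p i)) ([]=⇒lookup i∈πp))

module _ {n} (i j : Fin n) where

  transpose-matchˡ : transpose i j ⟨$⟩ʳ i ≡ j
  transpose-matchˡ rewrite dec-true (i ≟ i) refl = refl

  transpose-matchʳ : transpose i j ⟨$⟩ʳ j ≡ i
  transpose-matchʳ with j ≟ i
  ... | yes j≡i = j≡i
  ... | no _ rewrite dec-true (j ≟ j) refl = refl

  transpose-other : ∀ {k} → k ≢ i → k ≢ j → transpose i j ⟨$⟩ʳ k ≡ k
  transpose-other {k} k≢i k≢j rewrite dec-false (k ≟ i) k≢i | dec-false (k ≟ j) k≢j = refl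

-- For u ∈ e and w ∉ e this is e − u + w; going through the transposition (u w) makes it
-- injective on all subsets and the identity on those containing both u and w.
swap : ∀ {n} → Fin n → Fin n → Subset n → Subset n
swap u w = relabel (transpose u w)

module _ {n} {u w : Fin n} {e : Subset n} where

  ∈-swap : u ∈ e → w ∈ swap u w e
  ∈-swap u∈e = ∈-relabel⁺ (transpose u w) (subst (_∈ e) (sym (transpose-matchʳ u w)) u∈e)

  ∉-swap : w ∉ e → u ∉ swap u w e
  ∉-swap w∉e u∈swap = w∉e (subst (_∈ e) (transpose-matchˡ u w) (∈-relabel⁻ (transpose u w) u∈swap))

  swap-fixed : u ∈ e → w ∈ e → swap u w e ≡ e
  swap-fixed u∈e w∈e = Pointwise-≡⇒≡ (ext λ v → trans (lookup-relabel (transpose u w) e v) (fixed v))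
    where
    fixed : ∀ v → lookup e (transpose u w ⟨$⟩ʳ v) ≡ lookup e v
    fixed v with v ≟ u
    ... | yes refl = trans ([]=⇒lookup w∈e) (sym ([]=⇒lookup u∈e))
    ... | no _ with v ≟ w
    ...   | yes refl = trans ([]=⇒lookup u∈e) (sym ([]=⇒lookup w∈e))
    ...   | no _     = refl

  swap-other : ∀ {v} → v ≢ u → v ≢ w → (v ∈ e → v ∈ swap u w e) × (v ∈ swap u w e → v ∈ e)
  swap-other {v} v≢u v≢w =
    (λ v∈e → ∈-relabel⁺ (transpose u w) (subst (_∈ e) (sym fixes) v∈e)) ,
    (λ v∈swap → subst (_∈ e) fixes (∈-relabel⁻ (transpose u w) v∈swap))
    where
    fixes : transpose u w ⟨$⟩ʳ v ≡ v
    fixes = transpose-other u w v≢u v≢w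

  ∣swap∣ : u ∈ e → w ∉ e → ∣ swap u w e ∣ ≡ ∣ e ∣
  ∣swap∣ u∈e w∉e = begin
    ∣ swap u w e ∣                       ≡⟨ cong ∣_∣ swap≡update ⟩
    ∣ (e [ u ]≔ outside) [ w ]≔ inside ∣ ≡⟨ ∣p[i]≔inside∣ (e [ u ]≔ outside) w
                                              (trans (lookup∘update′ (u≢w ∘ sym) e outside) (∉⇒lookup≡outside w∉e)) ⟩
    suc ∣ e [ u ]≔ outside ∣             ≡⟨ ∣p[i]≔outside∣ e u ([]=⇒lookup u∈e) ⟩
    ∣ e ∣                                ∎
    where
    u≢w : u ≢ w
    u≢w u≡w = w∉e (subst (_∈ e) u≡w u∈e)
    moved : ∀ v → lookup e (transpose u w ⟨$⟩ʳ v) ≡ lookup ((e [ u ]≔ outside) [ w ]≔ inside) v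
    moved v with v ≟ u
    ... | yes refl = trans (∉⇒lookup≡outside w∉e)
                       (sym (trans (lookup∘update′ u≢w (e [ v ]≔ outside) inside) (lookup∘update v e outside)))
    ... | no v≢u with v ≟ w
    ...   | yes refl = trans ([]=⇒lookup u∈e) (sym (lookup∘update v (e [ u ]≔ outside) inside))
    ...   | no v≢w   = sym (trans (lookup∘update′ v≢w (e [ u ]≔ outside) inside) (lookup∘update′ v≢u e outside))
    swap≡update : swap u w e ≡ (e [ u ]≔ outside) [ w ]≔ inside
    swap≡update = Pointwise-≡⇒≡ (ext λ v → trans (lookup-relabel (transpose u w) e v) (moved v))

deg-++ : ∀ {n} (xs ys : Hypergraph n) v → deg (xs ++ ys) v ≡ deg xs v + deg ys v
deg-++ xs ys v = trans (cong length (filter-++ (v ∈?_) xs ys)) (length-++ (filter (v ∈?_) xs))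

module _ {n} {e : Subset n} {v : Fin n} where

  deg-[]-∈ : v ∈ e → deg [ e ] v ≡ 1
  deg-[]-∈ v∈e with v ∈? e
  ... | yes _   = refl
  ... | no v∉e = contradiction v∈e v∉e

  deg-[]-∉ : v ∉ e → deg [ e ] v ≡ 0
  deg-[]-∉ v∉e with v ∈? e
  ... | yes v∈e = contradiction v∈e v∉e
  ... | no _    = refl

deg-[]-cong : ∀ {n} {e e′ : Subset n} {v} → (v ∈ e → v ∈ e′) → (v ∈ e′ → v ∈ e) → deg [ e ] v ≡ deg [ e′ ] v
deg-[]-cong {e = e} {v = v} to from with v ∈? e
... | yes v∈e = sym (deg-[]-∈ (to v∈e))
... | no v∉e  = sym (deg-[]-∉ (v∉e ∘ from))

deg-replace : ∀ {n} ys zs (e e′ : Subset n) v →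
  deg (ys ++ e′ ∷ zs) v + deg [ e ] v ≡ deg (ys ++ e ∷ zs) v + deg [ e′ ] v
deg-replace ys zs e e′ v = begin
  deg (ys ++ e′ ∷ zs) v + deg [ e ] v                ≡⟨ cong (_+ deg [ e ] v) (split e′) ⟩
  deg ys v + (deg [ e′ ] v + deg zs v) + deg [ e ] v ≡⟨ shuffle (deg ys v) (deg [ e′ ] v) (deg zs v) (deg [ e ] v) ⟩
  deg ys v + (deg [ e ] v + deg zs v) + deg [ e′ ] v ≡⟨ cong (_+ deg [ e′ ] v) (split e) ⟨
  deg (ys ++ e ∷ zs) v + deg [ e′ ] v                ∎
  where
  split : ∀ x → deg (ys ++ x ∷ zs) v ≡ deg ys v + (deg [ x ] v + deg zs v)
  split x = trans (deg-++ ys (x ∷ zs) v) (cong (deg ys v +_) (deg-++ [ x ] zs v))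
  shuffle : ∀ a b c d → a + (b + c) + d ≡ a + (d + c) + b
  shuffle = solve-∀

replace-transfer : ∀ {n} ys zs {e e′ : Subset n} {u w} → u ∈ e → u ∉ e′ → w ∉ e → w ∈ e′ →
  (∀ {v} → v ≢ u → v ≢ w → (v ∈ e → v ∈ e′) × (v ∈ e′ → v ∈ e)) →
  UnitTransfer (deg (ys ++ e ∷ zs)) (deg (ys ++ e′ ∷ zs)) u w
replace-transfer ys zs {e} {e′} {u} {w} u∈e u∉e′ w∉e w∈e′ same = record
  { source = begin
      deg H u                 ≡⟨ +-identityʳ _ ⟨
      deg H u + 0             ≡⟨ cong (deg H u +_) (deg-[]-∉ u∉e′) ⟨
      deg H u + deg [ e′ ] u  ≡⟨ deg-replace ys zs e e′ u ⟨
      deg H′ u + deg [ e ] u  ≡⟨ cong (deg H′ u +_) (deg-[]-∈ u∈e) ⟩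
      deg H′ u + 1            ≡⟨ +-comm _ 1 ⟩
      suc (deg H′ u)          ∎
  ; target = begin
      deg H′ w                ≡⟨ +-identityʳ _ ⟨
      deg H′ w + 0            ≡⟨ cong (deg H′ w +_) (deg-[]-∉ w∉e) ⟨
      deg H′ w + deg [ e ] w  ≡⟨ deg-replace ys zs e e′ w ⟩
      deg H w + deg [ e′ ] w  ≡⟨ cong (deg H w +_) (deg-[]-∈ w∈e′) ⟩
      deg H w + 1             ≡⟨ +-comm _ 1 ⟩
      suc (deg H w)           ∎
  ; rest = λ v v≢u v≢w → let to , from = same v≢u v≢w in
      +-cancelʳ-≡ (deg [ e ] v) _ _ (trans (deg-replace ys zs e e′ v) (cong (deg H v +_) (sym (deg-[]-cong to from))))
  }
  where
  H H′ : Hypergraph _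
  H  = ys ++ e ∷ zs
  H′ = ys ++ e′ ∷ zs

Shiftable : ∀ {n} → Hypergraph n → Fin n → Fin n → Subset n → Set
Shiftable H u w e = u ∈ e × w ∉ e × swap u w e ∉ₗ H

shift : ∀ {n t} {H : Hypergraph n} {u w e} → Simple H → Uniform t H → e ∈ₗ H → Shiftable H u w e →
  ∃ λ H′ → Simple H′ × Uniform t H′ × UnitTransfer (deg H) (deg H′) u w
shift {u = u} {w} {e} simple uniform e∈H (u∈e , w∉e , fresh) with ys , zs , refl ← ∈-∃++ e∈H =
  ys ++ swap u w e ∷ zs ,
  Unique-replace ys fresh simple ,
  All-replace ys (trans (∣swap∣ u∈e w∉e) (All.lookup uniform e∈H)) uniform ,
  replace-transfer ys zs u∈e (∉-swap w∉e) w∉e (∈-swap u∈e) swap-other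

module _ {n} {H : Hypergraph n} (simple : Simple H) {u w : Fin n} where

  swap-closed⇒deg≤ : (∀ {e} → e ∈ₗ H → u ∈ e → w ∉ e → swap u w e ∈ₗ H) → deg H u ≤ deg H w
  swap-closed⇒deg≤ closed = subst (_≤ deg H w) (length-map (swap u w) (filter (u ∈?_) H))
    (Unique-⊆⇒length≤ _≟ₛ_ (Unique.map⁺ (relabel-injective (transpose u w)) (Unique.filter⁺ (u ∈?_) simple))
      swapped⊆)
    where
    swap∈H : ∀ {e} → e ∈ₗ H → u ∈ e → swap u w e ∈ₗ H
    swap∈H {e} e∈H u∈e with w ∈? e
    ... | yes w∈e = subst (_∈ₗ H) (sym (swap-fixed u∈e w∈e)) e∈H
    ... | no w∉e  = closed e∈H u∈e w∉e
    swapped⊆ : map (swap u w) (filter (u ∈?_) H) ⊆ filter (w ∈?_) H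
    swapped⊆ e′∈ with e , e∈ , refl ← ∈-map⁻ (swap u w) e′∈ =
      let e∈H , u∈e = ∈-filter⁻ (u ∈?_) {xs = H} e∈ in ∈-filter⁺ (w ∈?_) (swap∈H e∈H u∈e) (∈-swap u∈e)

  deg<⇒shiftable : deg H w < deg H u → ∃ λ e → e ∈ₗ H × Shiftable H u w e
  deg<⇒shiftable w<u with any? (λ e → u ∈? e ×-dec ¬? (w ∈? e) ×-dec ¬? (swap u w e ∈ₗ? H)) H
  ... | yes shiftable = find shiftable
  ... | no none       = contradiction (swap-closed⇒deg≤ closed) (<⇒≱ w<u)
    where
    closed : ∀ {e} → e ∈ₗ H → u ∈ e → w ∉ e → swap u w e ∈ₗ H
    closed {e} e∈H u∈e w∉e = decidable-stable (swap u w e ∈ₗ? H) (λ fresh → none (lose e∈H (u∈e , w∉e , fresh)))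

deg<⇒transfer : ∀ {n t} {H : Hypergraph n} {u w} → Simple H → Uniform t H → deg H w < deg H u →
  ∃ λ H′ → Simple H′ × Uniform t H′ × UnitTransfer (deg H) (deg H′) u w
deg<⇒transfer simple uniform w<u =
  let e , e∈H , shiftable = deg<⇒shiftable simple w<u in shift simple uniform e∈H shiftable

module Balancing {n} (t : ℕ) (U : Subset n) where

  members : List (Fin n)
  members = filter (_∈? U) (allFin n)

  Balanced : Hypergraph n → Set
  Balanced H = Σ (Hypergraph n) λ H′ → Simple H′ × Uniform t H′ ×
    ((v : Fin n) → v ∉ U → deg H v ≡ deg H′ v) × degSum H U ≡ degSum H′ U × AlmostRegular H′ U

  potential : Hypergraph n → ℕ
  potential H = sum (map (λ v → deg H v * deg H v) members)

  unique-members : Unique members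
  unique-members = Unique.filter⁺ (_∈? U) (Unique.allFin⁺ n)

  ∉U⇒≢member : ∀ {a v} → a ∈ₗ members → v ∉ U → v ≢ a
  ∉U⇒≢member a∈ v∉U refl = v∉U (proj₂ (∈-filter⁻ (_∈? U) {xs = allFin n} a∈))

  Balanced-transfer : ∀ {H H₁ a b} → UnitTransfer (deg H) (deg H₁) a b → a ∈ₗ members → b ∈ₗ members →
    Balanced H₁ → Balanced H
  Balanced-transfer transfer a∈ b∈ (H′ , simple , uniform , unchanged , total , regular) =
    H′ , simple , uniform ,
    (λ v v∉U → trans (sym (UnitTransfer.rest transfer v (∉U⇒≢member a∈ v∉U) (∉U⇒≢member b∈ v∉U)))
                     (unchanged v v∉U)) ,
    trans (sum-map-transfer _≟_ transfer unique-members a∈ b∈) total ,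
    regular

  balance : ∀ H → Acc _<_ (potential H) → Simple H → Uniform t H → Balanced H
  balance H (acc smaller) simple uniform with almostConstant-or-gap (deg H) members
  ... | inj₁ (k , almost) =
    H , simple , uniform , (λ _ _ → refl) , refl ,
    k , λ v v∈U → All.lookup almost (∈-filter⁺ (_∈? U) (∈-allFin v) v∈U)
  ... | inj₂ (a , b , a∈ , b∈ , gap) with deg<⇒transfer simple uniform (<-trans (n<1+n _) gap)
  ... | H₁ , simple₁ , uniform₁ , transfer = Balanced-transfer {H} {H₁} transfer a∈ b∈
          (balance H₁ (smaller (sum-map-square-transfer _≟_ transfer unique-members a∈ b∈ gap)) simple₁ uniform₁)

lemma1 : (t : ℕ) → t ≥ 2 → (n : ℕ) → (H : Hypergraph n) → Simple H → Uniform t H →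
    (U : Subset n) →
    Σ (Hypergraph n) λ H' → Simple H' × Uniform t H' ×
      ((v : Fin n) → v ∉ U → deg H v ≡ deg H' v) ×
      degSum H U ≡ degSum H' U ×
      AlmostRegular H' U
lemma1 t _ n H simple uniform U = balance H (<-wellFounded (potential H)) simple uniform
  where open Balancing t U
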